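{- Let $d$ be a positive integer, $\beta,\mu\in\mathbb{R}$, and let $G$ be a pinning of $F_{\beta,\mu,d}$. Define $H(x)=G(x)G(\bar x)$. Then there exist an integer $m\le d$ and a constant $K\ge0$ such that $H=K\cdot F_{2\beta,m}$.
   Context: For $\beta,\mu\in\mathbb{R}$ and $d\in\mathbb{N}$, $F_{\beta,\mu,d}:\{0,1\}^d\to\mathbb{R}_{\ge0}$ is the symmetric function taking value $e^{\beta i(d-i)+\mu i}$ on inputs with exactly $i$ coordinates equal to $1$, and $F_{\beta,d}=F_{\beta,0,d}$. A pinning of a symmetric $F:\{0,1\}^d\to\mathbb{R}_{\ge0}$ is a function $G(x_1,\dots,x_m)=F(x_1,\dots,x_m,0,\dots,0,1,\dots,1)$ with $d-b$ zeros and $a$ ones appended, for some $0\le a\le b\le d$, $m=b-a$. $\bar x$ is the bitwise complement of $x$. -}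

module Defs where

open import Data.Nat using (ℕ; zero; suc; _∸_) renaming (_*_ to _*ℕ_)
open import Data.Bool using (Bool; true; false; not)
open import Data.Vec using (Vec; []; _∷_; _++_; replicate; cast; map)
open import Algebra.Bundles using (CommutativeRing; CommutativeSemiring)
open import Relation.Binary.PropositionalEquality using (_≡_)
open import Level using (0ℓ)

-- Abstract stand-in for (ℝ, exp : ℝ → ℝ_{≥0}):
--  * E plays the role of ℝ as the domain of the parameters β, μ (a commutative ring),
--  * V plays the role of ℝ as the codomain of the functions F (a commutative semiring),
--  * exp is a homomorphism from (E,+) to (V,*) with non-negative values.
-- The reals with the usual exponential are an instance.
record ExpStructure : Set₁ where
  field
    E : CommutativeRing 0ℓ 0ℓ
    V : CommutativeSemiring 0ℓ 0ℓ
  module E = CommutativeRing E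
  module V = CommutativeSemiring V
  field
    _≤V_       : V.Carrier → V.Carrier → Set
    exp        : E.Carrier → V.Carrier
    exp-cong   : ∀ {x y} → x E.≈ y → exp x V.≈ exp y
    exp-+      : ∀ x y → exp (x E.+ y) V.≈ exp x V.* exp y
    exp-nonneg : ∀ x → V.0# ≤V exp x

ones : ∀ {n} → Vec Bool n → ℕ
ones [] = 0
ones (true ∷ xs) = suc (ones xs)
ones (false ∷ xs) = ones xs

compl : ∀ {n} → Vec Bool n → Vec Bool n
compl = map not

module _ (S : ExpStructure) where
  open ExpStructure S

  ι : ℕ → E.Carrier
  ι zero = E.0#
  ι (suc n) = E.1# E.+ ι n

  F : E.Carrier → E.Carrier → (d : ℕ) → Vec Bool d → V.Carrier
  F β μ d x = exp ((β E.* ι (i *ℕ (d ∸ i))) E.+ (μ E.* ι i))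
    where i = ones x

  F₀ : E.Carrier → (d : ℕ) → Vec Bool d → V.Carrier
  F₀ β d = F β E.0# d

  -- Pinning of F_{β,μ,d} with z = d − b zeros and a ones appended, arity m = b − a
  -- (so b = m + a and d = m + z + a).
  pinning : E.Carrier → E.Carrier → (d m z a : ℕ) → (m Data.Nat.+ z) Data.Nat.+ a ≡ d →
            Vec Bool m → V.Carrier
  pinning β μ d m z a eq x = F β μ d (cast eq ((x ++ replicate z false) ++ replicate a true))

-- If x has i ones and x̄ has k = m ∸ i, the pinned inputs have i + a and k + a ones out of
-- d = m + z + a, and (i + a)(k + z) + (k + a)(i + z) = 2ik + (mz + am + 2az) while
-- (i + a) + (k + a) = m + 2a. So G(x)G(x̄) = exp(2β·ik) · exp(β(mz + am + 2az) + μ(m + 2a)).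
module Submission where

open import Defs
open import Data.Nat using (ℕ; _≤_; _+_; suc)
open import Data.Bool using (Bool)
open import Data.Vec using (Vec)
open import Data.Product using (Σ; _×_)
open import Relation.Binary.PropositionalEquality using (_≡_)

open import Data.Nat using (zero; pred; _*_; _∸_)
open import Data.Nat.Properties using (+-suc; +-identityʳ; m+n∸m≡n; m≤m+n; ≤-trans)
open import Data.Nat.Tactic.RingSolver using (solve-∀)
open import Data.Bool using (true; false)
open import Data.Vec using ([]; _∷_; _++_; replicate; cast)
open import Data.Product using (_,_)
open import Data.Maybe using (nothing)
open import Relation.Binary.PropositionalEquality using (refl; cong; cong₂; sym; trans; subst; module ≡-Reasoning)
open import Tactic.RingSolver.Core.AlmostCommutativeRing using (fromCommutativeRing)
import Tactic.RingSolver.NonReflective as RingSolver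
import Relation.Binary.Reasoning.Setoid as SetoidReasoning

ones-cast : ∀ {n k} (eq : n ≡ k) (v : Vec Bool n) → ones (cast eq v) ≡ ones v
ones-cast {k = zero}  eq []          = refl
ones-cast {k = suc k} eq (true ∷ v)  = cong suc (ones-cast (cong pred eq) v)
ones-cast {k = suc k} eq (false ∷ v) = ones-cast (cong pred eq) v

ones-++ : ∀ {n k} (u : Vec Bool n) (v : Vec Bool k) → ones (u ++ v) ≡ ones u + ones v
ones-++ []          v = refl
ones-++ (true ∷ u)  v = cong suc (ones-++ u v)
ones-++ (false ∷ u) v = ones-++ u v

ones-replicate-false : ∀ n → ones (replicate n false) ≡ 0
ones-replicate-false zero    = refl
ones-replicate-false (suc n) = ones-replicate-false n

ones-replicate-true : ∀ n → ones (replicate n true) ≡ n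
ones-replicate-true zero    = refl
ones-replicate-true (suc n) = cong suc (ones-replicate-true n)

ones+ones-compl : ∀ {n} (x : Vec Bool n) → ones x + ones (compl x) ≡ n
ones+ones-compl []          = refl
ones+ones-compl (true ∷ x)  = cong suc (ones+ones-compl x)
ones+ones-compl (false ∷ x) = trans (+-suc (ones x) _) (cong suc (ones+ones-compl x))

ones-pinned : ∀ {m d} z a (eq : (m + z) + a ≡ d) (x : Vec Bool m) →
  ones (cast eq ((x ++ replicate z false) ++ replicate a true)) ≡ ones x + a
ones-pinned z a eq x = begin
  ones (cast eq ((x ++ replicate z false) ++ replicate a true)) ≡⟨ ones-cast eq _ ⟩
  ones ((x ++ replicate z false) ++ replicate a true)           ≡⟨ ones-++ (x ++ replicate z false) _ ⟩
  ones (x ++ replicate z false) + ones (replicate a true)       ≡⟨ cong₂ _+_ (ones-++ x _) (ones-replicate-true a) ⟩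
  ones x + ones (replicate z false) + a                         ≡⟨ cong (λ t → ones x + t + a) (ones-replicate-false z) ⟩
  ones x + 0 + a                                                ≡⟨ cong (_+ a) (+-identityʳ (ones x)) ⟩
  ones x + a                                                    ∎
  where open ≡-Reasoning

+≡⇒∸≡ : ∀ i {k n} → i + k ≡ n → n ∸ i ≡ k
+≡⇒∸≡ i {k} refl = m+n∸m≡n i k

pinningConstant : ℕ → ℕ → ℕ → ℕ
pinningConstant m z a = m * z + a * m + a * z + a * z

interaction-pinned : ∀ i k z a →
  (i + a) * (k + z) + (k + a) * (i + z) ≡ (i * k + i * k) + pinningConstant (i + k) z a
interaction-pinned = expanded
  where
  expanded : ∀ i k z a → (i + a) * (k + z) + (k + a) * (i + z)
    ≡ (i * k + i * k) + ((i + k) * z + a * (i + k) + a * z + a * z)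
  expanded = solve-∀

interaction-pinned-∸ : ∀ {m} i k z a → i + k ≡ m →
  (i + a) * ((m + z) + a ∸ (i + a)) + (k + a) * ((m + z) + a ∸ (k + a))
    ≡ (i * (m ∸ i) + i * (m ∸ i)) + pinningConstant m z a
interaction-pinned-∸ i k z a refl = begin
  (i + a) * (i + k + z + a ∸ (i + a)) + (k + a) * (i + k + z + a ∸ (k + a))
    ≡⟨ cong₂ (λ s t → (i + a) * s + (k + a) * t) (+≡⇒∸≡ (i + a) (rearrange i k z a)) (+≡⇒∸≡ (k + a) (rearrange-swap i k z a)) ⟩
  (i + a) * (k + z) + (k + a) * (i + z)
    ≡⟨ interaction-pinned i k z a ⟩
  (i * k + i * k) + pinningConstant (i + k) z a
    ≡⟨ cong (λ t → (i * t + i * t) + pinningConstant (i + k) z a) (sym (m+n∸m≡n i k)) ⟩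
  (i * (i + k ∸ i) + i * (i + k ∸ i)) + pinningConstant (i + k) z a ∎
  where
  open ≡-Reasoning
  rearrange : ∀ i k z a → (i + a) + (k + z) ≡ i + k + z + a
  rearrange = solve-∀
  rearrange-swap : ∀ i k z a → (k + a) + (i + z) ≡ i + k + z + a
  rearrange-swap = solve-∀

field-pinned : ∀ {m} i k a → i + k ≡ m → (i + a) + (k + a) ≡ m + a + a
field-pinned i k a refl = rearrange i k a
  where
  rearrange : ∀ i k a → (i + a) + (k + a) ≡ i + k + a + a
  rearrange = solve-∀

module _ (S : ExpStructure) where
  open ExpStructure S
  open RingSolver (fromCommutativeRing E (λ _ → nothing)) using (solve; _⊜_; _⊕_; _⊗_)

  ι-+ : ∀ p q → ι S (p + q) E.≈ ι S p E.+ ι S q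
  ι-+ zero    q = E.sym (E.+-identityˡ _)
  ι-+ (suc p) q = E.trans (E.+-congˡ (ι-+ p q)) (E.sym (E.+-assoc _ _ _))

  -- F β μ d x ≡ exp (exponent β μ d (ones x)) definitionally.
  exponent : E.Carrier → E.Carrier → ℕ → ℕ → E.Carrier
  exponent β μ d j = β E.* ι S (j * (d ∸ j)) E.+ μ E.* ι S j

  exponent-+ : ∀ β μ d j j' →
    exponent β μ d j E.+ exponent β μ d j'
      E.≈ β E.* ι S (j * (d ∸ j) + j' * (d ∸ j')) E.+ μ E.* ι S (j + j')
  exponent-+ β μ d j j' = E.trans
    (collect β μ _ _ _ _)
    (E.sym (E.+-cong (E.*-congˡ (ι-+ (j * (d ∸ j)) (j' * (d ∸ j')))) (E.*-congˡ (ι-+ j j'))))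
    where
    collect : ∀ β μ x x' y y' →
      (β E.* x E.+ μ E.* y) E.+ (β E.* x' E.+ μ E.* y') E.≈ β E.* (x E.+ x') E.+ μ E.* (y E.+ y')
    collect = solve 6 (λ β μ x x' y y' →
      ((β ⊗ x ⊕ μ ⊗ y) ⊕ (β ⊗ x' ⊕ μ ⊗ y')) ⊜ (β ⊗ (x ⊕ x') ⊕ μ ⊗ (y ⊕ y'))) E.refl

  split-doubled : ∀ β μ p c n →
    β E.* ι S ((p + p) + c) E.+ μ E.* ι S n
      E.≈ (β E.* ι S c E.+ μ E.* ι S n) E.+ (β E.+ β) E.* ι S p
  split-doubled β μ p c n = E.trans
    (E.+-congʳ (E.*-congˡ (E.trans (ι-+ (p + p) c) (E.+-congʳ (ι-+ p p)))))
    (E.trans (regroup β μ (ι S p) (ι S p) (ι S c) (ι S n)) (E.+-congˡ (E.sym (E.distribʳ (ι S p) β β))))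
    where
    -- p and p' are kept apart: the solver cannot add the coefficients of a repeated monomial.
    regroup : ∀ β μ p p' c n →
      β E.* ((p E.+ p') E.+ c) E.+ μ E.* n E.≈ (β E.* c E.+ μ E.* n) E.+ (β E.* p E.+ β E.* p')
    regroup = solve 6 (λ β μ p p' c n →
      (β ⊗ ((p ⊕ p') ⊕ c) ⊕ μ ⊗ n) ⊜ ((β ⊗ c ⊕ μ ⊗ n) ⊕ (β ⊗ p ⊕ β ⊗ p'))) E.refl

  exponent-zero-field : ∀ β d j → β E.* ι S (j * (d ∸ j)) E.≈ exponent β E.0# d j
  exponent-zero-field β d j = E.sym (E.trans (E.+-congˡ (E.zeroˡ _)) (E.+-identityʳ _))

  pinning-product : ∀ β μ {d} m z a (eq : (m + z) + a ≡ d) (x : Vec Bool m) →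
    pinning S β μ d m z a eq x V.* pinning S β μ d m z a eq (compl x)
      V.≈ exp (β E.* ι S (pinningConstant m z a) E.+ μ E.* ι S (m + a + a)) V.* F₀ S (β E.+ β) m x
  pinning-product β μ m z a refl x = begin
    exp (exponent β μ d I) V.* exp (exponent β μ d J)
      ≈⟨ V.sym (exp-+ _ _) ⟩
    exp (exponent β μ d I E.+ exponent β μ d J)
      ≈⟨ exp-cong (exponent-+ β μ d I J) ⟩
    exp (β E.* ι S (I * (d ∸ I) + J * (d ∸ J)) E.+ μ E.* ι S (I + J))
      ≡⟨ cong₂ (λ s t → exp (β E.* ι S s E.+ μ E.* ι S t)) interaction fields ⟩
    exp (β E.* ι S ((p + p) + pinningConstant m z a) E.+ μ E.* ι S (m + a + a))
      ≈⟨ exp-cong (E.trans (split-doubled β μ p (pinningConstant m z a) (m + a + a)) (E.+-congˡ (exponent-zero-field (β E.+ β) m i))) ⟩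
    exp ((β E.* ι S (pinningConstant m z a) E.+ μ E.* ι S (m + a + a)) E.+ exponent (β E.+ β) E.0# m i)
      ≈⟨ exp-+ _ _ ⟩
    exp (β E.* ι S (pinningConstant m z a) E.+ μ E.* ι S (m + a + a)) V.* F₀ S (β E.+ β) m x ∎
    where
    open SetoidReasoning V.setoid
    d = (m + z) + a
    i = ones x
    p = i * (m ∸ i)
    I = ones (cast refl ((x ++ replicate z false) ++ replicate a true))
    J = ones (cast refl ((compl x ++ replicate z false) ++ replicate a true))
    counts : i + ones (compl x) ≡ m
    counts = ones+ones-compl x
    interaction : I * (d ∸ I) + J * (d ∸ J) ≡ (p + p) + pinningConstant m z a
    interaction = trans
      (cong₂ (λ s t → s * (d ∸ s) + t * (d ∸ t)) (ones-pinned z a refl x) (ones-pinned z a refl (compl x)))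
      (interaction-pinned-∸ i (ones (compl x)) z a counts)
    fields : I + J ≡ m + a + a
    fields = trans
      (cong₂ _+_ (ones-pinned z a refl x) (ones-pinned z a refl (compl x)))
      (field-pinned i (ones (compl x)) a counts)

lemma6 : (S : ExpStructure) → let open ExpStructure S in
    (d : ℕ) → 1 ≤ d → (β μ : E.Carrier) →
    (m z a : ℕ) → (eq : (m + z) + a ≡ d) →
    m ≤ d × Σ V.Carrier (λ K → (V.0# ≤V K) ×
      ((x : Vec Bool m) →
        (pinning S β μ d m z a eq x V.* pinning S β μ d m z a eq (compl x))
          V.≈ (K V.* F₀ S (β E.+ β) m x)))
lemma6 S d _ β μ m z a eq =
  subst (m ≤_) eq (≤-trans (m≤m+n m z) (m≤m+n (m + z) a)) ,
  exp K , exp-nonneg K , pinning-product S β μ m z a eq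
  where
  open ExpStructure S
  K : E.Carrier
  K = β E.* ι S (pinningConstant m z a) E.+ μ E.* ι S (m + a + a)
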